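{- Let $\Pi$ be any one of the six sets $$\{[\overline{123}],[\overline{132}]\},\ \{[\overline{123}],[\overline{213}]\},\ \{[\overline{321}],[\overline{231}]\},\ \{[\overline{321}],[\overline{312}]\},\ \{[\overline{132}],[\overline{231}]\},\ \{[\overline{213}],[\overline{312}]\}.$$ Then $\left|\mathrm{Av}_n[\Pi]\right|=1$ for $n\le 2$ and $\left|\mathrm{Av}_n[\Pi]\right|=0$ for $n\ge 3$.
   Context: For $\sigma=\sigma_1\cdots\sigma_n\in S_n$, the cyclic permutation $[\sigma]$ is the set of all rotations of $\sigma$; $[S_n]$ denotes the set of cyclic permutations of length $n$. The pattern $[\overline{abc}]$ (two vincula) is contained in $[\sigma]$ if some three cyclically consecutive entries $\sigma_i\sigma_{i+1}\sigma_{i+2}$ (indices mod $n$, $n\ge3$) are order-isomorphic to $abc$; otherwise $[\sigma]$ avoids it. $\mathrm{Av}_n[\Pi]$ is the set of cyclic permutations in $[S_n]$ avoiding every pattern in $\Pi$ (for $n<3$ every cyclic permutation avoids such patterns). -}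

module Defs where

open import Data.Nat using (ℕ; suc; _<_)
open import Data.List using (List; []; _∷_; _++_; take; drop; map; upTo; length)
open import Data.List.Relation.Binary.Permutation.Propositional using (_↭_)
open import Data.List.Relation.Unary.All using (All)
open import Data.List.Relation.Unary.Any using (Any)
open import Data.List.Relation.Unary.AllPairs using (AllPairs)
open import Data.Product using (Σ; ∃; _×_; _,_; proj₁)
open import Relation.Nullary using (¬_)
open import Relation.Binary.PropositionalEquality using (_≡_)
open import Function.Bundles using (_⇔_)

Perm : ℕ → Set
Perm n = Σ (List ℕ) (λ σ → σ ↭ map suc (upTo n))

rotate : ℕ → List ℕ → List ℕ
rotate k σ = drop k σ ++ take k σ

SameCyclic : {n : ℕ} → Perm n → Perm n → Set
SameCyclic σ τ = ∃ λ k → proj₁ τ ≡ rotate k (proj₁ σ)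

record Pattern : Set where
  constructor pat
  field
    a b c : ℕ

OrderIso : ℕ → ℕ → ℕ → Pattern → Set
OrderIso x y z (pat a b c) =
  ((x < y) ⇔ (a < b)) × ((y < z) ⇔ (b < c)) × ((x < z) ⇔ (a < c))

-- [σ] contains [\overline{abc}] : some three cyclically consecutive entries
-- σ_i σ_{i+1} σ_{i+2} (indices mod n) are order-isomorphic to abc; these are
-- exactly the first three entries of the rotation starting at σ_i.
-- (For n < 3 no rotation has three entries, so nothing is contained.)
Contains : List ℕ → Pattern → Set
Contains σ p = ∃ λ k → ∃ λ x → ∃ λ y → ∃ λ z → ∃ λ rest →
  rotate k σ ≡ x ∷ y ∷ z ∷ rest × OrderIso x y z p

Avoids : List Pattern → List ℕ → Set
Avoids Π σ = All (λ p → ¬ Contains σ p) Π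

-- |Av_n[Π]| = m : there is a list of m permutations representing pairwise
-- distinct cyclic permutations, each avoiding Π, such that every cyclic
-- permutation [σ] ∈ [S_n] avoiding Π is one of them.
AvCard : ℕ → List Pattern → ℕ → Set
AvCard n Π m = Σ (List (Perm n)) λ reps →
  (length reps ≡ m) ×
  All (λ σ → Avoids Π (proj₁ σ)) reps ×
  AllPairs (λ σ τ → ¬ SameCyclic σ τ) reps ×
  ((σ : Perm n) → Avoids Π (proj₁ σ) → Any (SameCyclic σ) reps)

p123 p132 p213 p231 p312 p321 : Pattern
p123 = pat 1 2 3
p132 = pat 1 3 2
p213 = pat 2 1 3
p231 = pat 2 3 1
p312 = pat 3 1 2
p321 = pat 3 2 1

SixSets : List (List Pattern)
SixSets =
  (p123 ∷ p132 ∷ []) ∷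
  (p123 ∷ p213 ∷ []) ∷
  (p321 ∷ p231 ∷ []) ∷
  (p321 ∷ p312 ∷ []) ∷
  (p132 ∷ p231 ∷ []) ∷
  (p213 ∷ p312 ∷ []) ∷ []

{-# OPTIONS --safe #-}
-- For n ≥ 3 the entry 1 (or n) of a cyclic permutation sits at the first, middle or last
-- place of some cyclic window of three entries, and being the smallest (largest) entry of
-- that window it leaves only two possible patterns for it.  Each of the six sets Π
-- consists of exactly the two patterns with 1 (or 3) at one fixed place, so some window
-- realises a pattern of Π.  For n ≤ 2 there are no windows and every permutation of
-- 1,…,n is a rotation of the identity.
module Submission where

open import Defs
open import Data.Nat using (ℕ; suc; _+_; _≤_; _<_; _<?_; z≤n; s≤s)
open import Data.Nat.Properties using (≤∧≢⇒<; ≤⇒≯; <-cmp; <-asym; ≤-refl)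
open import Data.List using (List; []; _∷_; [_]; _++_; _∷ʳ_; map; upTo; length; take; drop)
open import Data.List.Properties
  using (∷-injectiveˡ; ∷-injectiveʳ; ++-assoc; ++-identityʳ; length-map; length-upTo; take++drop≡id)
open import Data.List.Membership.Propositional using (_∈_)
open import Data.List.Membership.Propositional.Properties using (∈-upTo⁺; ∈-map⁺; ∈-∃++)
open import Data.List.Relation.Unary.All using (All; []; _∷_; universal)
import Data.List.Relation.Unary.All as All
import Data.List.Relation.Unary.All.Properties as All
open import Data.List.Relation.Unary.Any using (Any; here; there)
open import Data.List.Relation.Unary.AllPairs using ([]; _∷_)
open import Data.List.Relation.Unary.Unique.Propositional using (Unique)
import Data.List.Relation.Unary.Unique.Propositional.Properties as Unique
open import Data.List.Relation.Binary.Permutation.Propositional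
  using (_↭_; refl; prep; swap; trans; ↭-sym; ↭⇒↭ₛ)
open import Data.List.Relation.Binary.Permutation.Propositional.Properties
  using (All-resp-↭; Any-resp-↭; ↭-length; ↭-empty-inv; ↭-singleton-inv)
  renaming (++-comm to ↭-++-comm)
import Data.List.Relation.Binary.Permutation.Setoid.Properties as Permutationₛ
open import Data.Product using (_×_; _,_; ∃; ∃₂)
open import Data.Sum using (_⊎_; inj₁; inj₂)
open import Data.Empty using (⊥-elim)
open import Function.Bundles using (_⇔_; mk⇔)
open import Relation.Binary using (tri<; tri≈; tri>)
open import Relation.Binary.PropositionalEquality
  using (_≡_; _≢_; refl; sym; cong; cong₂; subst; ≢-sym; setoid)
  renaming (trans to ≡-trans)
open import Relation.Nullary.Decidable using (True; toWitness)

Rotation : {A : Set} → List A → List A → Set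
Rotation σ τ = ∃₂ λ X Y → σ ≡ X ++ Y × τ ≡ Y ++ X

module _ {A : Set} where

  ++-≡-++-split : (Y X A′ B : List A) → Y ++ X ≡ A′ ++ B →
    (∃ λ Y′ → Y ≡ A′ ++ Y′ × B ≡ Y′ ++ X) ⊎ (∃ λ X′ → A′ ≡ Y ++ X′ × X ≡ X′ ++ B)
  ++-≡-++-split []      X A′       B eq = inj₂ (A′ , refl , eq)
  ++-≡-++-split (y ∷ Y) X []       B eq = inj₁ (y ∷ Y , refl , sym eq)
  ++-≡-++-split (y ∷ Y) X (a ∷ A′) B eq with refl ← ∷-injectiveˡ eq
    with ++-≡-++-split Y X A′ B (∷-injectiveʳ eq)
  ... | inj₁ (Y′ , e₁ , e₂) = inj₁ (Y′ , cong (y ∷_) e₁ , e₂)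
  ... | inj₂ (X′ , e₁ , e₂) = inj₂ (X′ , cong (y ∷_) e₁ , e₂)

  ∷-≡-∷ʳ : (a : A) (l : List A) → ∃₂ λ l′ b → a ∷ l ≡ l′ ∷ʳ b
  ∷-≡-∷ʳ a []      = [] , a , refl
  ∷-≡-∷ʳ a (b ∷ l) with l′ , c , eq ← ∷-≡-∷ʳ b l = a ∷ l′ , c , cong (a ∷_) eq

  rotation-refl : (σ : List A) → Rotation σ σ
  rotation-refl σ = [] , σ , refl , sym (++-identityʳ σ)

  rotation-trans : {σ τ ρ : List A} → Rotation σ τ → Rotation τ ρ → Rotation σ ρ
  rotation-trans (X , Y , refl , e₁) (A′ , B , e₂ , refl)
    with ++-≡-++-split Y X A′ B (≡-trans (sym e₁) e₂)
  ... | inj₁ (Y′ , refl , refl) = X ++ A′ , Y′ , sym (++-assoc X A′ Y′) , ++-assoc Y′ X A′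
  ... | inj₂ (X′ , refl , refl) = X′ , B ++ Y , ++-assoc X′ B Y , sym (++-assoc B Y X′)

  rotation-↭ : {σ τ : List A} → Rotation σ τ → τ ↭ σ
  rotation-↭ (X , Y , refl , refl) = ↭-++-comm Y X

  rotation-length : {σ τ : List A} → Rotation σ τ → length τ ≡ length σ
  rotation-length r = ↭-length (rotation-↭ r)

  drop-length-++ : (X Y : List A) → drop (length X) (X ++ Y) ≡ Y
  drop-length-++ []      Y = refl
  drop-length-++ (x ∷ X) Y = drop-length-++ X Y

  take-length-++ : (X Y : List A) → take (length X) (X ++ Y) ≡ X
  take-length-++ []      Y = refl
  take-length-++ (x ∷ X) Y = cong (x ∷_) (take-length-++ X Y)

  ↭⇒rotation : {σ τ : List A} → length σ ≤ 2 → σ ↭ τ → Rotation σ τ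
  ↭⇒rotation _ refl = rotation-refl _
  ↭⇒rotation _ (prep {xs = []} x p) with refl ← ↭-empty-inv (↭-sym p) = rotation-refl _
  ↭⇒rotation _ (prep {xs = _ ∷ []} x p) with refl ← ↭-singleton-inv (↭-sym p) = rotation-refl _
  ↭⇒rotation (s≤s (s≤s ())) (prep {xs = _ ∷ _ ∷ _} x p)
  ↭⇒rotation _ (swap {xs = []} x y p) with refl ← ↭-empty-inv (↭-sym p) = [ x ] , [ y ] , refl , refl
  ↭⇒rotation (s≤s (s≤s ())) (swap {xs = _ ∷ _} x y p)
  ↭⇒rotation σ≤2 (trans p q) =
    rotation-trans (↭⇒rotation σ≤2 p) (↭⇒rotation (subst (_≤ 2) (↭-length p) σ≤2) q)

rotate-rotation : (k : ℕ) (σ : List ℕ) → Rotation σ (rotate k σ)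
rotate-rotation k σ = take k σ , drop k σ , sym (take++drop≡id k σ) , refl

rotation⇒rotate : {σ τ : List ℕ} → Rotation σ τ → ∃ λ k → τ ≡ rotate k σ
rotation⇒rotate (X , Y , refl , refl) =
  length X , sym (cong₂ _++_ (drop-length-++ X Y) (take-length-++ X Y))

Window : {A : Set} → List A → A → A → A → Set
Window σ x y z = ∃ λ rest → Rotation σ (x ∷ y ∷ z ∷ rest)

module _ {A : Set} {σ : List A} where

  window-pred : ∀ {x y z} → Window σ x y z → ∃ λ w → Window σ w x y
  window-pred {x} {y} (rest , r) with l′ , w , eq ← ∷-≡-∷ʳ _ rest =
    w , l′ , rotation-trans r (x ∷ y ∷ l′ , [ w ] , cong (λ t → x ∷ y ∷ t) eq , refl)

  window-starting-at : ∀ {e} → e ∈ σ → 3 ≤ length σ → ∃₂ λ y z → Window σ e y z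
  window-starting-at e∈σ 3≤σ with ys , zs , refl ← ∈-∃++ e∈σ =
    window (zs ++ ys) (ys , _ ∷ zs , refl , refl)
    where
    window : ∀ {e} l → Rotation σ (e ∷ l) → ∃₂ λ y z → Window σ e y z
    window (y ∷ z ∷ rest) r = y , z , rest , r
    window []            r with s≤s () ← subst (3 ≤_) (sym (rotation-length r)) 3≤σ
    window (_ ∷ [])      r with s≤s (s≤s ()) ← subst (3 ≤_) (sym (rotation-length r)) 3≤σ

  window-centred-at : ∀ {e} → e ∈ σ → 3 ≤ length σ → ∃₂ λ x z → Window σ x e z
  window-centred-at e∈σ 3≤σ with y , _ , w ← window-starting-at e∈σ 3≤σ
    with x , w′ ← window-pred w = x , y , w′

  window-ending-at : ∀ {e} → e ∈ σ → 3 ≤ length σ → ∃₂ λ x y → Window σ x y e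
  window-ending-at e∈σ 3≤σ with x , _ , w ← window-centred-at e∈σ 3≤σ
    with x′ , w′ ← window-pred w = x′ , x , w′

  window-unique : ∀ {x y z} → Unique σ → Window σ x y z → x ≢ y × y ≢ z × x ≢ z
  window-unique σ! (_ , r)
    with (x≢y ∷ x≢z ∷ _) ∷ (y≢z ∷ _) ∷ _ ← Permutationₛ.Unique-resp-↭ (setoid A) (↭⇒↭ₛ (↭-sym (rotation-↭ r))) σ!
    = x≢y , y≢z , x≢z

  window-all : ∀ {P : A → Set} {x y z} → All P σ → Window σ x y z → P x × P y × P z
  window-all σP (_ , r) with px ∷ py ∷ pz ∷ _ ← All-resp-↭ (↭-sym (rotation-↭ r)) σP = px , py , pz

window⇒contains : ∀ {σ x y z} p → Window σ x y z → OrderIso x y z p → Contains σ p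
window⇒contains p (rest , r) iso with k , eq ← rotation⇒rotate r = k , _ , _ , _ , rest , sym eq , iso

contains⇒3≤length : ∀ {σ} p → Contains σ p → 3 ≤ length σ
contains⇒3≤length {σ} p (k , _ , _ , _ , rest , eq , _) =
  subst (3 ≤_) (≡-trans (cong length (sym eq)) (rotation-length (rotate-rotation k σ))) (s≤s (s≤s (s≤s z≤n)))

-- The side condition on the pattern entries is a closed instance of _<?_, solved by evaluation.
<⇔< : ∀ {x y a b} → x < y → {True (a <? b)} → (x < y) ⇔ (a < b)
<⇔< x<y {a<b} = mk⇔ (λ _ → toWitness a<b) (λ _ → x<y)

>⇔> : ∀ {x y a b} → y < x → {True (b <? a)} → (x < y) ⇔ (a < b)
>⇔> y<x {b<a} = mk⇔ (λ x<y → ⊥-elim (<-asym x<y y<x)) (λ a<b → ⊥-elim (<-asym a<b (toWitness b<a)))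

module _ {x y z : ℕ} where

  min-first : x < y → x < z → y ≢ z → OrderIso x y z p123 ⊎ OrderIso x y z p132
  min-first x<y x<z y≢z with <-cmp y z
  ... | tri< y<z _ _ = inj₁ (<⇔< x<y , <⇔< y<z , <⇔< x<z)
  ... | tri≈ _ y≡z _ = ⊥-elim (y≢z y≡z)
  ... | tri> _ _ z<y = inj₂ (<⇔< x<y , >⇔> z<y , <⇔< x<z)

  max-last : x < z → y < z → x ≢ y → OrderIso x y z p123 ⊎ OrderIso x y z p213
  max-last x<z y<z x≢y with <-cmp x y
  ... | tri< x<y _ _ = inj₁ (<⇔< x<y , <⇔< y<z , <⇔< x<z)
  ... | tri≈ _ x≡y _ = ⊥-elim (x≢y x≡y)
  ... | tri> _ _ y<x = inj₂ (>⇔> y<x , <⇔< y<z , <⇔< x<z)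

  min-last : z < x → z < y → x ≢ y → OrderIso x y z p321 ⊎ OrderIso x y z p231
  min-last z<x z<y x≢y with <-cmp x y
  ... | tri> _ _ y<x = inj₁ (>⇔> y<x , >⇔> z<y , >⇔> z<x)
  ... | tri≈ _ x≡y _ = ⊥-elim (x≢y x≡y)
  ... | tri< x<y _ _ = inj₂ (<⇔< x<y , >⇔> z<y , >⇔> z<x)

  max-first : y < x → z < x → y ≢ z → OrderIso x y z p321 ⊎ OrderIso x y z p312
  max-first y<x z<x y≢z with <-cmp y z
  ... | tri> _ _ z<y = inj₁ (>⇔> y<x , >⇔> z<y , >⇔> z<x)
  ... | tri≈ _ y≡z _ = ⊥-elim (y≢z y≡z)
  ... | tri< y<z _ _ = inj₂ (>⇔> y<x , <⇔< y<z , >⇔> z<x)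

  max-middle : x < y → z < y → x ≢ z → OrderIso x y z p132 ⊎ OrderIso x y z p231
  max-middle x<y z<y x≢z with <-cmp x z
  ... | tri< x<z _ _ = inj₁ (<⇔< x<y , >⇔> z<y , <⇔< x<z)
  ... | tri≈ _ x≡z _ = ⊥-elim (x≢z x≡z)
  ... | tri> _ _ z<x = inj₂ (<⇔< x<y , >⇔> z<y , >⇔> z<x)

  min-middle : y < x → y < z → x ≢ z → OrderIso x y z p213 ⊎ OrderIso x y z p312
  min-middle y<x y<z x≢z with <-cmp x z
  ... | tri< x<z _ _ = inj₁ (>⇔> y<x , <⇔< y<z , <⇔< x<z)
  ... | tri≈ _ x≡z _ = ⊥-elim (x≢z x≡z)
  ... | tri> _ _ z<x = inj₂ (>⇔> y<x , <⇔< y<z , >⇔> z<x)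

window⇒contains-either : ∀ {σ x y z} {p q} → Window σ x y z →
  OrderIso x y z p ⊎ OrderIso x y z q → Any (Contains σ) (p ∷ q ∷ [])
window⇒contains-either {p = p} w (inj₁ iso) = here (window⇒contains p w iso)
window⇒contains-either {q = q} w (inj₂ iso) = there (here (window⇒contains q w iso))

oneTo : ℕ → List ℕ
oneTo n = map suc (upTo n)

length-oneTo : ∀ n → length (oneTo n) ≡ n
length-oneTo n = ≡-trans (length-map suc (upTo n)) (length-upTo n)

↭-oneTo-length : ∀ {σ n} → σ ↭ oneTo n → length σ ≡ n
↭-oneTo-length {n = n} σ↭ = ≡-trans (↭-length σ↭) (length-oneTo n)

oneTo-unique : ∀ n → Unique (oneTo n)
oneTo-unique n = Unique.map⁺ (λ { refl → refl }) (Unique.upTo⁺ n)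

oneTo-bounded : ∀ n → All (λ v → 1 ≤ v × v ≤ n) (oneTo n)
oneTo-bounded n = All.map⁺ (All.map (λ v<n → s≤s z≤n , v<n) (All.all-upTo n))

1∈oneTo : ∀ m → 1 ∈ oneTo (suc m)
1∈oneTo m = ∈-map⁺ suc (∈-upTo⁺ (s≤s z≤n))

max∈oneTo : ∀ m → suc m ∈ oneTo (suc m)
max∈oneTo m = ∈-map⁺ suc (∈-upTo⁺ ≤-refl)

short-avoids : ∀ Π {σ} → length σ ≤ 2 → Avoids Π σ
short-avoids Π σ≤2 = universal (λ p c → ≤⇒≯ σ≤2 (contains⇒3≤length p c)) Π

module _ (m : ℕ) {σ : List ℕ} (σ↭ : σ ↭ oneTo (3 + m)) where

  private
    3≤σ : 3 ≤ length σ
    3≤σ = subst (3 ≤_) (sym (↭-oneTo-length σ↭)) (s≤s (s≤s (s≤s z≤n)))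

    σ-unique : Unique σ
    σ-unique = Permutationₛ.Unique-resp-↭ (setoid ℕ) (↭⇒↭ₛ (↭-sym σ↭)) (oneTo-unique (3 + m))

    σ-bounded : All (λ v → 1 ≤ v × v ≤ 3 + m) σ
    σ-bounded = All-resp-↭ (↭-sym σ↭) (oneTo-bounded (3 + m))

    1∈σ : 1 ∈ σ
    1∈σ = Any-resp-↭ (↭-sym σ↭) (1∈oneTo (2 + m))

    max∈σ : 3 + m ∈ σ
    max∈σ = Any-resp-↭ (↭-sym σ↭) (max∈oneTo (2 + m))

  contains-123-or-132 : Any (Contains σ) (p123 ∷ p132 ∷ [])
  contains-123-or-132
    with _ , _ , w ← window-starting-at 1∈σ 3≤σ
    with 1≢y , y≢z , 1≢z ← window-unique σ-unique w
    with _ , (1≤y , _) , (1≤z , _) ← window-all σ-bounded w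
    = window⇒contains-either w (min-first (≤∧≢⇒< 1≤y 1≢y) (≤∧≢⇒< 1≤z 1≢z) y≢z)

  contains-123-or-213 : Any (Contains σ) (p123 ∷ p213 ∷ [])
  contains-123-or-213
    with _ , _ , w ← window-ending-at max∈σ 3≤σ
    with x≢y , y≢N , x≢N ← window-unique σ-unique w
    with (_ , x≤N) , (_ , y≤N) , _ ← window-all σ-bounded w
    = window⇒contains-either w (max-last (≤∧≢⇒< x≤N x≢N) (≤∧≢⇒< y≤N y≢N) x≢y)

  contains-321-or-231 : Any (Contains σ) (p321 ∷ p231 ∷ [])
  contains-321-or-231
    with _ , _ , w ← window-ending-at 1∈σ 3≤σ
    with x≢y , y≢1 , x≢1 ← window-unique σ-unique w
    with (1≤x , _) , (1≤y , _) , _ ← window-all σ-bounded w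
    = window⇒contains-either w (min-last (≤∧≢⇒< 1≤x (≢-sym x≢1)) (≤∧≢⇒< 1≤y (≢-sym y≢1)) x≢y)

  contains-321-or-312 : Any (Contains σ) (p321 ∷ p312 ∷ [])
  contains-321-or-312
    with _ , _ , w ← window-starting-at max∈σ 3≤σ
    with N≢y , y≢z , N≢z ← window-unique σ-unique w
    with _ , (_ , y≤N) , (_ , z≤N) ← window-all σ-bounded w
    = window⇒contains-either w (max-first (≤∧≢⇒< y≤N (≢-sym N≢y)) (≤∧≢⇒< z≤N (≢-sym N≢z)) y≢z)

  contains-132-or-231 : Any (Contains σ) (p132 ∷ p231 ∷ [])
  contains-132-or-231
    with _ , _ , w ← window-centred-at max∈σ 3≤σ
    with x≢N , N≢z , x≢z ← window-unique σ-unique w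
    with (_ , x≤N) , _ , (_ , z≤N) ← window-all σ-bounded w
    = window⇒contains-either w (max-middle (≤∧≢⇒< x≤N x≢N) (≤∧≢⇒< z≤N (≢-sym N≢z)) x≢z)

  contains-213-or-312 : Any (Contains σ) (p213 ∷ p312 ∷ [])
  contains-213-or-312
    with _ , _ , w ← window-centred-at 1∈σ 3≤σ
    with x≢1 , 1≢z , x≢z ← window-unique σ-unique w
    with (1≤x , _) , _ , (1≤z , _) ← window-all σ-bounded w
    = window⇒contains-either w (min-middle (≤∧≢⇒< 1≤x (≢-sym x≢1)) (≤∧≢⇒< 1≤z 1≢z) x≢z)

  contains-one-of : ∀ {Π} → Π ∈ SixSets → Any (Contains σ) Π
  contains-one-of (here refl)                                         = contains-123-or-132
  contains-one-of (there (here refl))                                 = contains-123-or-213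
  contains-one-of (there (there (here refl)))                         = contains-321-or-231
  contains-one-of (there (there (there (here refl))))                 = contains-321-or-312
  contains-one-of (there (there (there (there (here refl)))))         = contains-132-or-231
  contains-one-of (there (there (there (there (there (here refl)))))) = contains-213-or-312

proposition4p1 : (Π : List Pattern) → Π ∈ SixSets → (n : ℕ) →
    (n ≤ 2 → AvCard n Π 1) × (3 ≤ n → AvCard n Π 0)
proposition4p1 Π Π∈ n = short , long
  where
  short : n ≤ 2 → AvCard n Π 1
  short n≤2 =
    (oneTo n , refl) ∷ [] , refl ,
    short-avoids Π (length≤2 refl) ∷ [] ,
    [] ∷ [] ,
    λ (σ , σ↭) _ → here (rotation⇒rotate (↭⇒rotation (length≤2 σ↭) σ↭))
    where
    length≤2 : ∀ {σ} → σ ↭ oneTo n → length σ ≤ 2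
    length≤2 σ↭ = subst (_≤ 2) (sym (↭-oneTo-length σ↭)) n≤2

  long : 3 ≤ n → AvCard n Π 0
  long (s≤s (s≤s (s≤s {n = m} _))) =
    [] , refl , [] , [] ,
    λ (σ , σ↭) σ-avoids → ⊥-elim (All.All¬⇒¬Any σ-avoids (contains-one-of m σ↭ Π∈))
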